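{- For all integers $n\geq 2$ and $j,k\geq 0$, $$ \gcd\big(s_j(n),s_k(n)\big)=s_m(n), \qquad\text{where } 2m+1=\gcd(2j+1,2k+1). $$
   Context: For an integer $n$, the sequence $(s_k(n))_{k\in\mathbb{Z}}$ is defined by $s_0(n)=1$, $s_1(n)=n+1$ and $s_{k+2}(n)=n\,s_{k+1}(n)-s_k(n)$ for all $k\in\mathbb{Z}$. -}

module Defs where

open import Data.Nat using (ℕ; zero; suc)
open import Data.Integer using (ℤ; +_; _+_; _-_; _*_)

s : ℕ → ℤ → ℤ
s zero n = + 1
s (suc zero) n = n + + 1
s (suc (suc k)) n = n * s (suc k) n - s k n

{-# OPTIONS --safe #-}
module Submission where

-- Extending s to negative indices by s (-1 - k) = - s k keeps the recurrence valid, so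
-- s (a + t) + s (a - t) = V t · s a for the companion Lucas sequence V. With a = k and
-- t = j - k this gives gcd (s j, s k) = gcd (s j', s k), where s (k - t) = ± s j', i.e.
-- 2j' + 1 = ∣2(2k + 1) - (2j + 1)∣: a Euclid-type step on the odd numbers 2j + 1, 2k + 1.
-- As s k 2 = 2k + 1, the same step at n = 2 shows that gcd (2j + 1, 2k + 1) is unchanged,
-- and the descent ends at j = k, where gcd (s k, s k) = s k since s ≥ 0 for n ≥ 2.

open import Defs
open import Data.Nat using (ℕ; zero; suc; _∸_; s≤s; z≤n) renaming (_+_ to _+ℕ_; _*_ to _*ℕ_; _<_ to _<ℕ_; _≤_ to _≤ℕ_)
open import Data.Nat.GCD using (GCD; gcd-GCD) renaming (gcd to gcdℕ; gcd-comm to gcdℕ-comm)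
open import Data.Nat.Divisibility using (∣-antisym)
open import Data.Nat.Induction using (<-rec)
import Data.Nat.Properties as ℕ
open import Data.Integer using (ℤ; +_; -[1+_]; 0ℤ; _+_; _-_; _*_; -_; _⊖_; ∣_∣; _≤_; +≤+; nonNegative)
open import Data.Integer.GCD using (gcd; gcd-greatest; gcd[i,j]∣i; gcd[i,j]∣j; gcd-comm)
import Data.Integer.Divisibility as Unsigned
import Data.Integer.Divisibility.Signed as Signed
import Data.Integer.Properties as ℤ
open import Data.Integer.Tactic.RingSolver using (solve-∀)
open import Data.Sum using (inj₁; inj₂)
open import Relation.Binary.PropositionalEquality

module _ (n : ℤ) where

  lucasV : ℕ → ℤ
  lucasV zero = + 2
  lucasV (suc zero) = n
  lucasV (suc (suc t)) = n * lucasV (suc t) - lucasV t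

  SolvesRecurrence : (ℤ → ℤ) → Set
  SolvesRecurrence f = ∀ i → f (i + + 2) ≡ n * f (i + + 1) - f i

  module _ {f : ℤ → ℤ} (rec : SolvesRecurrence f) where

    recurrence-centred : ∀ i → f (i + + 1) + f (i - + 1) ≡ n * f i
    recurrence-centred i = begin
      f (i + + 1) + f (i - + 1)                         ≡⟨ cong (λ j → f j + f (i - + 1)) (shift₂ i) ⟩
      f (i - + 1 + + 2) + f (i - + 1)                   ≡⟨ cong (_+ f (i - + 1)) (rec (i - + 1)) ⟩
      n * f (i - + 1 + + 1) - f (i - + 1) + f (i - + 1) ≡⟨ cancel (n * f (i - + 1 + + 1)) (f (i - + 1)) ⟩
      n * f (i - + 1 + + 1)                             ≡⟨ cong (λ j → n * f j) (shift₁ i) ⟩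
      n * f i                                           ∎
      where
        open ≡-Reasoning
        shift₂ : ∀ i → i + + 1 ≡ i - + 1 + + 2
        shift₂ = solve-∀
        shift₁ : ∀ i → i - + 1 + + 1 ≡ i
        shift₁ = solve-∀
        cancel : ∀ x y → x - y + y ≡ x
        cancel = solve-∀

    addition-formula : ∀ t a → f (a + + t) + f (a - + t) ≡ lucasV t * f a
    addition-formula zero a = trans (cong₂ _+_ (cong f (ℤ.+-identityʳ a)) (cong f (ℤ.+-identityʳ a))) (double (f a))
      where
        double : ∀ x → x + x ≡ + 2 * x
        double = solve-∀
    addition-formula (suc zero) a = recurrence-centred a
    addition-formula (suc (suc t)) a = begin
      P + Q                                       ≡⟨ regroup P Q A B ⟩
      (P + A) + (B + Q) - (A + B)                 ≡⟨ cong₂ (λ x y → x + y - (A + B)) outer inner ⟩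
      n * f (a + + suc t) + n * f (a - + suc t) - (A + B)
                                                  ≡⟨ cong (_- (A + B)) (sym (ℤ.*-distribˡ-+ n _ _)) ⟩
      n * (f (a + + suc t) + f (a - + suc t)) - (A + B)
                                                  ≡⟨ cong₂ (λ x y → n * x - y) (addition-formula (suc t) a) (addition-formula t a) ⟩
      n * (lucasV (suc t) * f a) - lucasV t * f a ≡⟨ factor n (lucasV (suc t)) (lucasV t) (f a) ⟩
      lucasV (suc (suc t)) * f a                  ∎
      where
        open ≡-Reasoning
        P = f (a + + suc (suc t))
        Q = f (a - + suc (suc t))
        A = f (a + + t)
        B = f (a - + t)
        regroup : ∀ p q x y → p + q ≡ (p + x) + (y + q) - (x + y)
        regroup = solve-∀
        factor : ∀ m v₁ v₀ x → m * (v₁ * x) - v₀ * x ≡ (m * v₁ - v₀) * x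
        factor = solve-∀
        centred-at : ∀ {i j k} → i + + 1 ≡ j → i - + 1 ≡ k → f j + f k ≡ n * f i
        centred-at {i} refl refl = recurrence-centred i
        +up : ∀ a t → a + (+ 1 + t) + + 1 ≡ a + (+ 1 + (+ 1 + t))
        +up = solve-∀
        +down : ∀ a t → a + (+ 1 + t) - + 1 ≡ a + t
        +down = solve-∀
        -up : ∀ a t → a - (+ 1 + t) + + 1 ≡ a - t
        -up = solve-∀
        -down : ∀ a t → a - (+ 1 + t) - + 1 ≡ a - (+ 1 + (+ 1 + t))
        -down = solve-∀
        outer : P + A ≡ n * f (a + + suc t)
        outer = centred-at (+up a (+ t)) (+down a (+ t))
        inner : B + Q ≡ n * f (a - + suc t)
        inner = centred-at (-up a (+ t)) (-down a (+ t))

sℤ : ℤ → ℤ → ℤ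
sℤ n (+ k) = s k n
sℤ n -[1+ k ] = - s k n

sℤ-solvesRecurrence : ∀ n → SolvesRecurrence n (sℤ n)
sℤ-solvesRecurrence n (+ k) rewrite ℕ.+-comm k 2 | ℕ.+-comm k 1 = refl
sℤ-solvesRecurrence n -[1+ 0 ] = at₋₁ n
  where
    at₋₁ : ∀ n → n + + 1 ≡ n * + 1 - - + 1
    at₋₁ = solve-∀
sℤ-solvesRecurrence n -[1+ 1 ] = at₋₂ n
  where
    at₋₂ : ∀ n → + 1 ≡ n * - + 1 - - (n + + 1)
    at₋₂ = solve-∀
sℤ-solvesRecurrence n -[1+ suc (suc k) ] = negated n (s k n) (s (suc k) n)
  where
    negated : ∀ n x y → - x ≡ n * - y - - (n * y - x)
    negated = solve-∀

-- sℤ n i = ± s (foldIndex i) n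
foldIndex : ℤ → ℕ
foldIndex (+ k) = k
foldIndex -[1+ k ] = k

foldIndex-⊖-< : ∀ k t → 0 <ℕ t → foldIndex (k ⊖ t) <ℕ k +ℕ t
foldIndex-⊖-< zero (suc t) _ = ℕ.n<1+n t
foldIndex-⊖-< (suc k) (suc zero) _ = s≤s (ℕ.m≤m+n k 1)
foldIndex-⊖-< (suc k) (suc (suc t)) _ rewrite ℤ.[1+m]⊖[1+n]≡m⊖n k (suc t) =
  ℕ.m<n⇒m<1+n (ℕ.<-≤-trans (foldIndex-⊖-< k (suc t) (s≤s z≤n)) (ℕ.+-monoʳ-≤ k (ℕ.n≤1+n (suc t))))

gcd-shift : ∀ x y b c → x + y ≡ c * b → gcd x b ≡ gcd y b
gcd-shift x y b c x+y≡cb =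
  cong +_ (∣-antisym (divides x y x+y≡cb) (divides y x (trans (ℤ.+-comm y x) x+y≡cb)))
  where
    divides : ∀ u v → u + v ≡ c * b → gcd u b Unsigned.∣ gcd v b
    divides u v eq = gcd-greatest {v} {b} {gcd u b} (Signed.∣⇒∣ᵤ d∣v) (gcd[i,j]∣j u b)
      where
        d∣v : gcd u b Signed.∣ v
        d∣v = Signed.∣m+n∣m⇒∣n {m = u}
                (subst (gcd u b Signed.∣_) (sym eq) (Signed.∣n⇒∣m*n c (Signed.∣ᵤ⇒∣ (gcd[i,j]∣j u b))))
                (Signed.∣ᵤ⇒∣ (gcd[i,j]∣i u b))

gcd-sℤ : ∀ n i b → gcd (sℤ n i) b ≡ gcd (s (foldIndex i) n) b
gcd-sℤ n (+ k) b = refl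
gcd-sℤ n -[1+ k ] b = cong (λ x → + gcdℕ x ∣ b ∣) (ℤ.∣-i∣≡∣i∣ (s k n))

gcd-s-descent : ∀ n k t → gcd (s (k +ℕ t) n) (s k n) ≡ gcd (s (foldIndex (k ⊖ t)) n) (s k n)
gcd-s-descent n k t = begin
  gcd (s (k +ℕ t) n) (s k n)          ≡⟨ gcd-shift (s (k +ℕ t) n) (sℤ n (+ k - + t)) (s k n) (lucasV n t) addition ⟩
  gcd (sℤ n (+ k - + t)) (s k n)      ≡⟨ cong (λ i → gcd (sℤ n i) (s k n)) (ℤ.m-n≡m⊖n k t) ⟩
  gcd (sℤ n (k ⊖ t)) (s k n)          ≡⟨ gcd-sℤ n (k ⊖ t) (s k n) ⟩
  gcd (s (foldIndex (k ⊖ t)) n) (s k n) ∎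
  where
    open ≡-Reasoning
    addition : s (k +ℕ t) n + sℤ n (+ k - + t) ≡ lucasV n t * s k n
    addition = addition-formula n {sℤ n} (sℤ-solvesRecurrence n) t (+ k)

s-at-2 : ∀ k → s k (+ 2) ≡ + (2 *ℕ k +ℕ 1)
s-at-2 zero = refl
s-at-2 (suc zero) = refl
s-at-2 (suc (suc k)) = begin
  + 2 * s (suc k) (+ 2) - s k (+ 2)                    ≡⟨ cong₂ (λ x y → + 2 * x - y) (s-at-2 (suc k)) (s-at-2 k) ⟩
  + 2 * + (2 *ℕ suc k +ℕ 1) - + (2 *ℕ k +ℕ 1)          ≡⟨ cong₂ (λ x y → + 2 * x - y) (odd (suc k)) (odd k) ⟩
  + 2 * (+ 2 * (+ 1 + + k) + + 1) - (+ 2 * + k + + 1)  ≡⟨ odd-recurrence (+ k) ⟩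
  + 2 * (+ 1 + (+ 1 + + k)) + + 1                       ≡⟨ sym (odd (suc (suc k))) ⟩
  + (2 *ℕ suc (suc k) +ℕ 1)                             ∎
  where
    open ≡-Reasoning
    odd : ∀ k → + (2 *ℕ k +ℕ 1) ≡ + 2 * + k + + 1
    odd k = trans (ℤ.pos-+ (2 *ℕ k) 1) (cong (_+ + 1) (ℤ.pos-* 2 k))
    odd-recurrence : ∀ k → + 2 * (+ 2 * (+ 1 + k) + + 1) - (+ 2 * k + + 1) ≡ + 2 * (+ 1 + (+ 1 + k)) + + 1
    odd-recurrence = solve-∀

gcd-odd-descent : ∀ k t → gcdℕ (2 *ℕ (k +ℕ t) +ℕ 1) (2 *ℕ k +ℕ 1) ≡ gcdℕ (2 *ℕ foldIndex (k ⊖ t) +ℕ 1) (2 *ℕ k +ℕ 1)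
gcd-odd-descent k t = ℤ.+-injective (begin
  gcd (+ (2 *ℕ (k +ℕ t) +ℕ 1)) (+ (2 *ℕ k +ℕ 1))             ≡⟨ cong₂ gcd (sym (s-at-2 (k +ℕ t))) (sym (s-at-2 k)) ⟩
  gcd (s (k +ℕ t) (+ 2)) (s k (+ 2))                        ≡⟨ gcd-s-descent (+ 2) k t ⟩
  gcd (s (foldIndex (k ⊖ t)) (+ 2)) (s k (+ 2))             ≡⟨ cong₂ gcd (s-at-2 (foldIndex (k ⊖ t))) (s-at-2 k) ⟩
  gcd (+ (2 *ℕ foldIndex (k ⊖ t) +ℕ 1)) (+ (2 *ℕ k +ℕ 1)) ∎)
  where open ≡-Reasoning

gcdℕ-idem : ∀ a → gcdℕ a a ≡ a
gcdℕ-idem a = GCD.unique (gcd-GCD a a) GCD.refl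

odd-injective : ∀ {m j} → 2 *ℕ m +ℕ 1 ≡ 2 *ℕ j +ℕ 1 → m ≡ j
odd-injective {m} {j} eq = ℕ.*-cancelˡ-≡ m j 2 (ℕ.+-cancelʳ-≡ 1 (2 *ℕ m) (2 *ℕ j) eq)

module _ {n : ℤ} (2≤n : + 2 ≤ n) where

  mutual
    s-nonneg : ∀ k → 0ℤ ≤ s k n
    s-nonneg zero = +≤+ z≤n
    s-nonneg (suc k) = ℤ.≤-trans (s-nonneg k) (s-increasing k)

    s-increasing : ∀ k → s k n ≤ s (suc k) n
    s-increasing zero = ℤ.i≤j+i (+ 1) n {{nonNegative (ℤ.≤-trans (+≤+ z≤n) 2≤n)}}
    s-increasing (suc k) = begin
      s (suc k) n                       ≡⟨ twice-minus (s (suc k) n) ⟩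
      + 2 * s (suc k) n - s (suc k) n   ≤⟨ ℤ.+-monoʳ-≤ (+ 2 * s (suc k) n) (ℤ.neg-mono-≤ (s-increasing k)) ⟩
      + 2 * s (suc k) n - s k n         ≤⟨ ℤ.+-monoˡ-≤ (- s k n) (ℤ.*-monoʳ-≤-nonNeg (s (suc k) n) {{nonNegative (s-nonneg (suc k))}} 2≤n) ⟩
      n * s (suc k) n - s k n           ∎
      where
        open ℤ.≤-Reasoning
        twice-minus : ∀ x → x ≡ + 2 * x - x
        twice-minus = solve-∀

  GcdFormula : ℕ → ℕ → Set
  GcdFormula j k = ∀ m → 2 *ℕ m +ℕ 1 ≡ gcdℕ (2 *ℕ j +ℕ 1) (2 *ℕ k +ℕ 1) → gcd (s j n) (s k n) ≡ s m n

  gcdFormula-refl : ∀ j → GcdFormula j j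
  gcdFormula-refl j m 2m+1≡gcd = begin
    gcd (s j n) (s j n) ≡⟨ cong +_ (gcdℕ-idem ∣ s j n ∣) ⟩
    + ∣ s j n ∣         ≡⟨ ℤ.0≤i⇒+∣i∣≡i (s-nonneg j) ⟩
    s j n               ≡⟨ cong (λ i → s i n) (odd-injective {j} {m} (trans (sym (gcdℕ-idem _)) (sym 2m+1≡gcd))) ⟩
    s m n               ∎
    where open ≡-Reasoning

  gcdFormula-sym : ∀ j k → GcdFormula k j → GcdFormula j k
  gcdFormula-sym j k formula m 2m+1≡gcd =
    trans (gcd-comm (s j n) (s k n)) (formula m (trans 2m+1≡gcd (gcdℕ-comm (2 *ℕ j +ℕ 1) (2 *ℕ k +ℕ 1))))

  gcdFormula-descent : ∀ k t → GcdFormula (foldIndex (k ⊖ t)) k → GcdFormula (k +ℕ t) k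
  gcdFormula-descent k t formula m 2m+1≡gcd =
    trans (gcd-s-descent n k t) (formula m (trans 2m+1≡gcd (gcd-odd-descent k t)))

  gcdFormula-≥ : ∀ j k → k ≤ℕ j → GcdFormula j k
  gcdFormula-≥ = <-rec (λ j → ∀ k → k ≤ℕ j → GcdFormula j k) step
    where
      step : ∀ j → (∀ {i} → i <ℕ j → ∀ k → k ≤ℕ i → GcdFormula i k) → ∀ k → k ≤ℕ j → GcdFormula j k
      step j formula-below k k≤j with ℕ.m≤n⇒m<n∨m≡n k≤j
      ... | inj₂ refl = gcdFormula-refl k
      ... | inj₁ k<j = subst (λ i → GcdFormula i k) k+t≡j (gcdFormula-descent k t (below fold<j k<j))
        where
          t = j ∸ k
          k+t≡j : k +ℕ t ≡ j
          k+t≡j = ℕ.m+[n∸m]≡n (ℕ.<⇒≤ k<j)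
          fold<j : foldIndex (k ⊖ t) <ℕ j
          fold<j = subst (foldIndex (k ⊖ t) <ℕ_) k+t≡j (foldIndex-⊖-< k t (ℕ.m<n⇒0<n∸m k<j))
          below : ∀ {a b} → a <ℕ j → b <ℕ j → GcdFormula a b
          below {a} {b} a<j b<j with ℕ.≤-total b a
          ... | inj₁ b≤a = formula-below a<j b b≤a
          ... | inj₂ a≤b = gcdFormula-sym a b (formula-below b<j a a≤b)

  gcdFormula : ∀ j k → GcdFormula j k
  gcdFormula j k with ℕ.≤-total k j
  ... | inj₁ k≤j = gcdFormula-≥ j k k≤j
  ... | inj₂ j≤k = gcdFormula-sym j k (gcdFormula-≥ k j j≤k)

lemma29 : (n : ℤ) → + 2 ≤ n → (j k m : ℕ) →
          2 *ℕ m +ℕ 1 ≡ gcdℕ (2 *ℕ j +ℕ 1) (2 *ℕ k +ℕ 1) →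
          gcd (s j n) (s k n) ≡ s m n
lemma29 n 2≤n = gcdFormula 2≤n
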